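{- Let $\mathsf{K}_{\mathsf{At}}$ be an FH model and $HMS^*(\mathsf{K}_{\mathsf{At}})$ its truncated HMS transform. For all $w \in W_{\mathsf{At}}$, all $\varphi \in \mathcal{L}_{\mathsf{At}}$, and all $\Phi \subseteq \mathsf{At}$ with $\mathsf{At}(\varphi) \subseteq \Phi$: $\mathsf{K}_{\mathsf{At}}, w \Vdash \varphi$ if and only if $HMS^*(\mathsf{K}_{\mathsf{At}}), w_\Phi \vDash \varphi$.
   Context: Fix nonempty sets $\mathsf{At}$ (atoms) and $I$ (agents). Language $\mathcal{L}_{\mathsf{At}}$: $\varphi ::= \top\mid p\mid\neg\varphi\mid\varphi\wedge\psi\mid\ell_i\varphi\mid a_i\varphi\mid k_i\varphi$; $\mathsf{At}(\varphi)$ atoms of $\varphi$; $\mathsf{At}(X) := \bigcup_{\varphi\in X}\mathsf{At}(\varphi)$; $\mathcal{L}_\Phi := \{\varphi:\mathsf{At}(\varphi)\subseteq\Phi\}$. FH model $\mathsf{K}_\Phi = \langle I, W_\Phi, (R_{\Phi,i}), (\mathcal{A}_{\Phi,i}), V_\Phi\rangle$: $W_\Phi\neq\emptyset$; $R_{\Phi,i}$ equivalence relations; $\mathcal{A}_{\Phi,i}:W_\Phi\to 2^{\mathcal{L}_\Phi}$ with $\varphi\in\mathcal{A}_{\Phi,i}(w)$ iff $\mathsf{At}(\varphi)\subseteq\mathcal{A}_{\Phi,i}(w)$, and $(w,t)\in R_{\Phi,i}\Rightarrow\mathcal{A}_{\Phi,i}(w)=\mathcal{A}_{\Phi,i}(t)$;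 $V_\Phi:\Phi\to 2^{W_\Phi}$. FH satisfaction: $\top$ always; $p$ iff $w\in V_\Phi(p)$; Boolean standard; $a_i\varphi$ iff $\varphi\in\mathcal{A}_{\Phi,i}(w)$; $\ell_i\varphi$ iff $\varphi$ at all $R_{\Phi,i}$-successors; $k_i\varphi$ iff $\ell_i\varphi$ and $a_i\varphi$. Surjective bounded morphism $f^\Phi_\Psi:W_\Phi\to W_\Psi$ ($\Psi\subseteq\Phi$): surjective; $w\in V_\Phi(p)\iff f^\Phi_\Psi(w)\in V_\Psi(p)$ for $p\in\Psi$; $\mathcal{A}_{\Phi,i}(w)\cap\mathcal{L}_\Psi = \mathcal{A}_{\Psi,i}(f^\Phi_\Psi(w))$; preserves $R_i$; back condition (if $(f^\Phi_\Psi(w),t')\in R_{\Psi,i}$ there is $t$ with $f^\Phi_\Psi(t)=t'$ and $(w,t)\in R_{\Phi,i}$). Category of FH models for $\mathsf{K}_{\mathsf{At}}$: FH models $\mathsf{K}_\Phi$ for all $\Phi\subseteq\mathsf{At}$ (top one $\mathsf{K}_{\mathsf{At}}$) with surjective bounded morphisms $f^\Phi_\Psi$, $f^\Phi_\Phi$ identity, $f^\Phi_\Upsilon=f^\Psi_\Upsilon\circ f^\Phi_\Psi$. Truncated HMS transform $HMS^*(\mathsf{K}_{\mathsf{At}}) = \langle I, \{S_\Phi\}, (r^\Phi_\Psi), (\Lambda^*_i), (\alpha_i), v\rangle$: $S_\Phi := W_\Phi$ (pairwise disjoint), $\Omega := \bigcup_\Phi S_\Phi$, $r^\Phi_\Psi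 := f^\Phi_\Psi$; for $w\in S_\Phi$, $\Lambda^*_i(w) := \{w' : (w,w')\in R_{\Phi,i}\}$; for $w\in S_\Psi$, $\alpha_i(w) := S_{\mathsf{At}(\mathcal{A}_{\Psi,i}(w))}$; $v(p) := \bigcup_{\Phi\ni p}V_\Phi(p)$. Here $S_\Psi\preceq S_\Phi$ iff $\Psi\subseteq\Phi$; $\omega_\Psi := r^\Phi_\Psi(\omega)$; $D^\uparrow := \bigcup_{\Phi\subseteq\Psi}(r^\Psi_\Phi)^{ -1}(D)$ for $D\subseteq S_\Phi$; events: sets $E=D^\uparrow$ with base-space $S(E):=S_\Phi$ (distinct vacuous events $\emptyset^{S_\Phi}$ for each $\Phi$); $\neg E := (S_\Phi\setminus D)^\uparrow$. Satisfaction in an implicit knowledge-based HMS model (with $[\varphi] := \{\omega:\omega\vDash\varphi\}$ and $\Pi^*_i(\omega_\Phi) := \Lambda^*_i(\omega)_{\alpha_i(\omega_\Phi)}$ for $\omega\in\Omega$, $S_\Phi$ below the space of $\omega$, where $D_S$ is the projection of $D$ to $S$): $\top$ everywhere; $p$ iff $\omega\in v(p)$; $\neg\varphi$ iff $\omega\in\neg[\varphi]$; $\varphi\wedge\psi$ iff $\omega\in[\varphi]\cap[\psi]$; $a_i\varphi$ iff $\alpha_i(\omega)\succeq S([\varphi])$; $\ell_i\varphi$ iff $\Lambda^*_i(\omega)\subseteq[\varphi]$; $k_i\varphi$ iff $\Pi^*_i(\omega)\subseteq[\varphi]$. -}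

module Defs where

open import Level using (0ℓ)
open import Data.Empty using (⊥)
open import Data.Unit using (⊤)
open import Data.Product using (Σ; ∃; _×_; _,_)
open import Data.Sum using (_⊎_)
open import Relation.Nullary using (¬_)
open import Relation.Unary using (Pred; _⊆_; U)
open import Relation.Binary using (IsEquivalence)
open import Relation.Binary.PropositionalEquality using (_≡_)
open import Function.Bundles using (_⇔_)

module _ (At I : Set) where

  data Form : Set where
    ⊤'   : Form
    atom : At → Form
    ¬'_  : Form → Form
    _∧'_ : Form → Form → Form
    ℓ    : I → Form → Form
    a    : I → Form → Form
    k    : I → Form → Form

  Subset : Set₁
  Subset = Pred At 0ℓ

  AtF : Form → Subset
  AtF ⊤'        p = ⊥
  AtF (atom q)  p = p ≡ q
  AtF (¬' φ)    p = AtF φ p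
  AtF (φ ∧' ψ)  p = AtF φ p ⊎ AtF ψ p
  AtF (ℓ i φ)   p = AtF φ p
  AtF (a i φ)   p = AtF φ p
  AtF (k i φ)   p = AtF φ p

  AtS : Pred Form 0ℓ → Subset
  AtS X p = Σ Form λ φ → X φ × AtF φ p

  record FHModel (Φ : Subset) : Set₁ where
    field
      W        : Set
      W-ne     : W
      R        : I → W → W → Set
      R-equiv  : ∀ i → IsEquivalence (R i)
      A        : I → W → Pred Form 0ℓ
      A-lang   : ∀ i w φ → A i w φ → AtF φ ⊆ Φ
      A-gen    : ∀ i w φ → A i w φ ⇔ (∀ {p} → AtF φ p → A i w (atom p))
      A-R      : ∀ i w t → R i w t → ∀ φ → A i w φ ⇔ A i t φ
      -- valuation V_Φ : Φ → 2^W (only values at p ∈ Φ are relevant)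
      V        : At → Pred W 0ℓ

  module FHSat {Φ : Subset} (M : FHModel Φ) where
    open FHModel M
    _⊩_ : W → Form → Set
    w ⊩ ⊤'       = ⊤
    w ⊩ atom p   = V p w
    w ⊩ (¬' φ)   = ¬ (w ⊩ φ)
    w ⊩ (φ ∧' ψ) = (w ⊩ φ) × (w ⊩ ψ)
    w ⊩ ℓ i φ    = ∀ t → R i w t → t ⊩ φ
    w ⊩ a i φ    = A i w φ
    w ⊩ k i φ    = (∀ t → R i w t → t ⊩ φ) × A i w φ

  record FHCategory : Set₁ where
    field
      K : (Φ : Subset) → FHModel Φ
    Wd : Subset → Set
    Wd Φ = FHModel.W (K Φ)
    Rd : (Φ : Subset) → I → Wd Φ → Wd Φ → Set
    Rd Φ = FHModel.R (K Φ)
    Ad : (Φ : Subset) → I → Wd Φ → Pred Form 0ℓ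
    Ad Φ = FHModel.A (K Φ)
    Vd : (Φ : Subset) → At → Pred (Wd Φ) 0ℓ
    Vd Φ = FHModel.V (K Φ)
    field
      f      : (Φ Ψ : Subset) → Ψ ⊆ Φ → Wd Φ → Wd Ψ
      f-surj : ∀ Φ Ψ (q : Ψ ⊆ Φ) (t : Wd Ψ) → Σ (Wd Φ) λ w → f Φ Ψ q w ≡ t
      f-val  : ∀ Φ Ψ (q : Ψ ⊆ Φ) w p → Ψ p → Vd Φ p w ⇔ Vd Ψ p (f Φ Ψ q w)
      f-aw   : ∀ Φ Ψ (q : Ψ ⊆ Φ) i w φ →
               (Ad Φ i w φ × AtF φ ⊆ Ψ) ⇔ Ad Ψ i (f Φ Ψ q w) φ
      f-forth : ∀ Φ Ψ (q : Ψ ⊆ Φ) i w t → Rd Φ i w t → Rd Ψ i (f Φ Ψ q w) (f Φ Ψ q t)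
      f-back  : ∀ Φ Ψ (q : Ψ ⊆ Φ) i w t' → Rd Ψ i (f Φ Ψ q w) t' →
                Σ (Wd Φ) λ t → f Φ Ψ q t ≡ t' × Rd Φ i w t
      f-id    : ∀ Φ (q : Φ ⊆ Φ) w → f Φ Φ q w ≡ w
      f-comp  : ∀ Φ Ψ Υ (q₁ : Ψ ⊆ Φ) (q₂ : Υ ⊆ Ψ) (q₃ : Υ ⊆ Φ) w →
                f Φ Υ q₃ w ≡ f Ψ Υ q₂ (f Φ Ψ q₁ w)

    Top : FHModel U
    Top = K U

    -- At(A_{Φ,i}(w)) ⊆ Φ, so α_i(w) lies below the space of w
    αsub : ∀ Φ i w → AtS (Ad Φ i w) ⊆ Φ
    αsub Φ i w (φ , aw , m) = FHModel.A-lang (K Φ) i w φ aw m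

    -- Satisfaction in the truncated HMS transform HMS*(K_At).
    -- A state ω ∈ S_Φ is a pair (Φ , w) with w ∈ W_Φ; [φ] has base space S_{At(φ)}.
    _,_⊨_ : (Φ : Subset) → Wd Φ → Form → Set
    Φ , w ⊨ ⊤'       = ⊤
    Φ , w ⊨ atom p   = Φ p × Vd Φ p w
    Φ , w ⊨ (¬' φ)   = Σ (AtF φ ⊆ Φ) λ q →                  -- ω ∈ ¬[φ]
                         ¬ (AtF φ , f Φ (AtF φ) q w ⊨ φ)
    Φ , w ⊨ (φ ∧' ψ) = (Φ , w ⊨ φ) × (Φ , w ⊨ ψ)
    Φ , w ⊨ ℓ i φ    = ∀ t → Rd Φ i w t → Φ , t ⊨ φ
    Φ , w ⊨ a i φ    = AtF φ ⊆ AtS (Ad Φ i w)              -- α_i(ω) ⪰ S([φ])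
    Φ , w ⊨ k i φ    = ∀ t → Rd Φ i w t →                  -- Π*_i(ω) ⊆ [φ]
                         AtS (Ad Φ i w) , f Φ (AtS (Ad Φ i w)) (αsub Φ i w) t ⊨ φ

{-# OPTIONS --safe #-}
module Submission where

-- First, FH satisfaction of φ is invariant under every
-- bounded morphism f^Φ_Ψ with At(φ) ⊆ Ψ.  Second, at a state of S_Φ with
-- At(φ) ⊆ Φ, HMS* satisfaction agrees with FH satisfaction in K_Φ: the clauses
-- for ¬ and k evaluate φ at a projection to a lower space (S_At(φ), resp.
-- α_i(w)), and invariance carries that evaluation back to K_Φ.  The HMS* clause
-- for k does not mention awareness; it is recovered because a state satisfying
-- φ lies in a space containing At(φ), and R_i is reflexive.

open import Defs
open import Relation.Unary using (_⊆_; U)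
open import Relation.Binary using (IsEquivalence)
open import Relation.Binary.PropositionalEquality using (refl)
open import Data.Product using (_,_; proj₁; proj₂)
open import Data.Product.Function.NonDependent.Propositional using (_×-⇔_)
open import Data.Sum using (inj₁; inj₂)
open import Relation.Nullary using (¬_)
open import Function.Base using (_∘_)
open import Function.Bundles using (_⇔_; mk⇔; Equivalence)
open import Function.Construct.Identity using (⇔-id)
open import Function.Construct.Composition using (_⇔-∘_)
open import Function.Related.TypeIsomorphisms using (¬-cong-⇔)

open Equivalence

module _ {At I : Set} where

  aware⇔AtF⊆AtS : ∀ {Φ} (M : FHModel At I Φ) i w φ →
                  FHModel.A M i w φ ⇔ AtF At I φ ⊆ AtS At I (FHModel.A M i w)
  aware⇔AtF⊆AtS M i w φ = mk⇔
    (λ aw {p} p∈φ → atom p , to (A-gen i w φ) aw p∈φ , refl)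
    (λ cover → from (A-gen i w φ) λ p∈φ → aware-of-atom (cover p∈φ))
    where
    open FHModel M
    aware-of-atom : ∀ {p} → AtS At I (A i w) p → A i w (atom p)
    aware-of-atom (ψ , aw , p∈ψ) = to (A-gen i w ψ) aw p∈ψ

  module _ (C : FHCategory At I) where
    open FHCategory C

    Sat : (Φ : Subset At I) → Wd Φ → Form At I → Set
    Sat Φ = FHSat._⊩_ At I (K Φ)

    Rd-refl : ∀ Φ i w → Rd Φ i w w
    Rd-refl Φ i w = IsEquivalence.refl (FHModel.R-equiv (K Φ) i)

    module _ {Φ Ψ : Subset At I} (Ψ⊆Φ : Ψ ⊆ Φ) where

      private
        π : Wd Φ → Wd Ψ
        π = f Φ Ψ Ψ⊆Φ

      □-transfer : ∀ {P : Wd Φ → Set} {Q : Wd Ψ → Set} i w →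
                   (∀ t → P t ⇔ Q (π t)) →
                   (∀ t → Rd Φ i w t → P t) ⇔ (∀ t′ → Rd Ψ i (π w) t′ → Q t′)
      □-transfer {P} {Q} i w P⇔Q = mk⇔ forth back
        where
        forth : (∀ t → Rd Φ i w t → P t) → ∀ t′ → Rd Ψ i (π w) t′ → Q t′
        forth P-succ t′ r with f-back Φ Ψ Ψ⊆Φ i w t′ r
        ... | t , refl , r′ = to (P⇔Q t) (P-succ t r′)
        back : (∀ t′ → Rd Ψ i (π w) t′ → Q t′) → ∀ t → Rd Φ i w t → P t
        back Q-succ t r = from (P⇔Q t) (Q-succ (π t) (f-forth Φ Ψ Ψ⊆Φ i w t r))

      aware-transfer : ∀ i w φ → AtF At I φ ⊆ Ψ → Ad Φ i w φ ⇔ Ad Ψ i (π w) φ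
      aware-transfer i w φ φ⊆Ψ = mk⇔
        (λ aw → to (f-aw Φ Ψ Ψ⊆Φ i w φ) (aw , φ⊆Ψ))
        (λ aw → proj₁ (from (f-aw Φ Ψ Ψ⊆Φ i w φ) aw))

      Sat-invariant : ∀ w φ → AtF At I φ ⊆ Ψ → Sat Φ w φ ⇔ Sat Ψ (π w) φ
      Sat-invariant w ⊤'       φ⊆Ψ = ⇔-id _
      Sat-invariant w (atom p) φ⊆Ψ = f-val Φ Ψ Ψ⊆Φ w p (φ⊆Ψ refl)
      Sat-invariant w (¬' φ)   φ⊆Ψ = ¬-cong-⇔ (Sat-invariant w φ φ⊆Ψ)
      Sat-invariant w (φ ∧' ψ) φψ⊆Ψ =
        Sat-invariant w φ (φψ⊆Ψ ∘ inj₁) ×-⇔ Sat-invariant w ψ (φψ⊆Ψ ∘ inj₂)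
      Sat-invariant w (ℓ i φ)  φ⊆Ψ =
        □-transfer i w λ t → Sat-invariant t φ φ⊆Ψ
      Sat-invariant w (a i φ)  φ⊆Ψ = aware-transfer i w φ φ⊆Ψ
      Sat-invariant w (k i φ)  φ⊆Ψ =
        (□-transfer i w λ t → Sat-invariant t φ φ⊆Ψ) ×-⇔ aware-transfer i w φ φ⊆Ψ

    ⊨⇒AtF⊆ : ∀ Φ w φ → Φ , w ⊨ φ → AtF At I φ ⊆ Φ
    ⊨⇒AtF⊆ Φ w (atom p) (p∈Φ , _) refl     = p∈Φ
    ⊨⇒AtF⊆ Φ w (¬' φ)   (φ⊆Φ , _)          = φ⊆Φ
    ⊨⇒AtF⊆ Φ w (φ ∧' ψ) (⊨φ , _) (inj₁ p∈φ) = ⊨⇒AtF⊆ Φ w φ ⊨φ p∈φ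
    ⊨⇒AtF⊆ Φ w (φ ∧' ψ) (_ , ⊨ψ) (inj₂ p∈ψ) = ⊨⇒AtF⊆ Φ w ψ ⊨ψ p∈ψ
    ⊨⇒AtF⊆ Φ w (ℓ i φ)  ⊨□φ                = ⊨⇒AtF⊆ Φ w φ (⊨□φ w (Rd-refl Φ i w))
    ⊨⇒AtF⊆ Φ w (a i φ)  φ⊆Aw               = αsub Φ i w ∘ φ⊆Aw
    ⊨⇒AtF⊆ Φ w (k i φ)  ⊨kφ                =
      αsub Φ i w ∘ ⊨⇒AtF⊆ _ _ φ (⊨kφ w (Rd-refl Φ i w))

    mutual
      Sat⇔⊨ : ∀ Φ w φ → AtF At I φ ⊆ Φ → Sat Φ w φ ⇔ Φ , w ⊨ φ
      Sat⇔⊨ Φ w ⊤'       φ⊆Φ  = ⇔-id _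
      Sat⇔⊨ Φ w (atom p) p⊆Φ  = mk⇔ (p⊆Φ refl ,_) proj₂
      Sat⇔⊨ Φ w (¬' φ)   φ⊆Φ  = mk⇔ forth back
        where
        negated : (φ⊆Φ′ : AtF At I φ ⊆ Φ) →
                  (¬ Sat Φ w φ) ⇔ (¬ AtF At I φ , f Φ (AtF At I φ) φ⊆Φ′ w ⊨ φ)
        negated φ⊆Φ′ = ¬-cong-⇔ (Sat⇔⊨-projection φ⊆Φ′ w φ (λ p∈φ → p∈φ))
        forth : Sat Φ w (¬' φ) → Φ , w ⊨ (¬' φ)
        forth ⊮φ = φ⊆Φ , to (negated φ⊆Φ) ⊮φ
        back : Φ , w ⊨ (¬' φ) → Sat Φ w (¬' φ)
        back (φ⊆Φ′ , ⊭φ) = from (negated φ⊆Φ′) ⊭φ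
      Sat⇔⊨ Φ w (φ ∧' ψ) φψ⊆Φ =
        Sat⇔⊨ Φ w φ (φψ⊆Φ ∘ inj₁) ×-⇔ Sat⇔⊨ Φ w ψ (φψ⊆Φ ∘ inj₂)
      Sat⇔⊨ Φ w (ℓ i φ)  φ⊆Φ  = mk⇔
        (λ ⊩□φ t r → to   (Sat⇔⊨ Φ t φ φ⊆Φ) (⊩□φ t r))
        (λ ⊨□φ t r → from (Sat⇔⊨ Φ t φ φ⊆Φ) (⊨□φ t r))
      Sat⇔⊨ Φ w (a i φ)  φ⊆Φ  = aware⇔AtF⊆AtS (K Φ) i w φ
      Sat⇔⊨ Φ w (k i φ)  φ⊆Φ  = mk⇔
        (λ (⊩□φ , aw) t r → to (Sat⇔⊨-projection α t φ (to aware aw)) (⊩□φ t r))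
        (λ ⊨kφ → let φ⊆Aw = ⊨⇒AtF⊆ _ _ φ (⊨kφ w (Rd-refl Φ i w)) in
                 (λ t r → from (Sat⇔⊨-projection α t φ φ⊆Aw) (⊨kφ t r))
                 , from aware φ⊆Aw)
        where
        α : AtS At I (Ad Φ i w) ⊆ Φ
        α = αsub Φ i w
        aware : Ad Φ i w φ ⇔ AtF At I φ ⊆ AtS At I (Ad Φ i w)
        aware = aware⇔AtF⊆AtS (K Φ) i w φ

      Sat⇔⊨-projection : ∀ {Φ Ψ} (Ψ⊆Φ : Ψ ⊆ Φ) w φ → AtF At I φ ⊆ Ψ →
                         Sat Φ w φ ⇔ Ψ , f Φ Ψ Ψ⊆Φ w ⊨ φ
      Sat⇔⊨-projection Ψ⊆Φ w φ φ⊆Ψ =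
        Sat⇔⊨ _ _ φ φ⊆Ψ ⇔-∘ Sat-invariant Ψ⊆Φ w φ φ⊆Ψ

corollary4 : {At I : Set} → At → I → (C : FHCategory At I) →
    (w : FHCategory.Wd C (U {A = At})) (φ : Form At I) (Φ : Subset At I) →
    (q : AtF At I φ ⊆ Φ) →
    FHSat._⊩_ At I (FHCategory.Top C) w φ
      ⇔ FHCategory._,_⊨_ C Φ (FHCategory.f C U Φ (λ _ → _) w) φ
corollary4 _ _ C w φ Φ q = Sat⇔⊨-projection C (λ _ → _) w φ q
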